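{- Let $H$ be a planar hypermap with a pointed vertex $v$. Then there is a unique mirror-well-labelling $\ell$ of the vertices of $H$ such that $v$ is the unique right local min and $\ell(v)=0$. This labelling is the geodesic labelling with respect to $v$, i.e. $\ell(u)$ is the length of a shortest directed path from $v$ to $u$ in the canonical orientation of $H$.
   Context: A hypermap is a planar map (connected graph embedded in the sphere) with all vertices of even degree, together with a proper bicolouring of its faces into dark and light faces (every edge has a dark face on one side and a light face on the other). A mirror-well-labelling is a labelling $\ell:V(H)\to\mathbb{Z}$ such that for any edge $\{a,b\}$, with the dark face incident to it on the left when traversed from $a$ to $b$, $\ell(b)\ge\ell(a)-1$. A right neighbour of a vertex $u$ is a vertex $w$ adjacent to $u$ such that the edge traversed from $w$ to $u$ has a dark face on its right; $u$ is a right local min if every right neighbour $w$ satisfies $\ell(w)\ge\ell(u)$. The canonical orientation of $H$ orients each edge so that its incident dark face is on its right. -}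

module Defs where

open import Data.Nat using (ℕ; zero; suc; _+_; _*_; _≤_; _<_; _≤ᵇ_)
open import Data.Integer as ℤ using (ℤ; +_)
open import Data.Fin using (Fin; toℕ)
open import Data.Fin.Permutation using (Permutation′; _⟨$⟩ʳ_)
open import Data.Bool using (Bool; true; false; not)
open import Data.List using (List; []; _∷_; length; filter; upTo; allFin)
open import Data.Bool using (_∧_)
open import Data.Product using (Σ; ∃; ∃-syntax; _×_; _,_)
open import Function using (_∘_)
open import Relation.Nullary using (¬_)
open import Relation.Binary.PropositionalEquality using (_≡_; _≢_)
open import Relation.Nullary.Decidable using (True)
open import Data.Bool using (T)

allB : ∀ {A : Set} → (A → Bool) → List A → Bool
allB p []       = true
allB p (x ∷ xs) = p x ∧ allB p xs

iter : ∀ {A : Set} → (A → A) → ℕ → A → A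
iter f zero    x = x
iter f (suc k) x = f (iter f k x)

-- Number of cycles of a permutation p of Fin n: count the darts d that are the
-- minimal element (w.r.t. toℕ) of their p-orbit {p^k d | k < n}.
isCycleRep : ∀ {n} → (Fin n → Fin n) → Fin n → Bool
isCycleRep {n} p d = allB (λ k → toℕ d ≤ᵇ toℕ (iter p k d)) (upTo n)

#cycles : ∀ {n} → (Fin n → Fin n) → ℕ
#cycles {n} p = length (filter (λ d → T? (isCycleRep p d)) (allFin n))
  where
  open import Data.Bool.Properties using () renaming (T? to T?)

data Reach {n} (σ α : Fin n → Fin n) (a : Fin n) : Fin n → Set where
  reach-refl : Reach σ α a a
  reach-σ    : ∀ {b} → Reach σ α a b → Reach σ α a (σ b)
  reach-α    : ∀ {b} → Reach σ α a b → Reach σ α a (α b)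

-- Combinatorial planar map on darts Fin n (an edge = 2 darts, n = 2·#edges).
--   σ : rotation of darts counterclockwise around their origin vertex (vertices = σ-orbits)
--   α : fixed-point-free involution sending a dart to the reverse dart (edges = α-orbits)
--   φ = σ ∘ α : traces the face lying to the RIGHT of a dart (faces = φ-orbits)
-- A hypermap additionally has every vertex of even degree and a proper dark/light
-- colouring of faces, encoded as darkR d = "the face to the right of dart d is dark",
-- which is constant on faces and differs on the two sides of every edge.
record Hypermap (n : ℕ) : Set where
  field
    σ       : Permutation′ n
    α       : Permutation′ n
    darkR   : Fin n → Bool
  σf : Fin n → Fin n
  σf = σ ⟨$⟩ʳ_
  αf : Fin n → Fin n
  αf = α ⟨$⟩ʳ_
  φf : Fin n → Fin n
  φf = σf ∘ αf
  field
    α-invol     : ∀ d → αf (αf d) ≡ d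
    α-fpfree    : ∀ d → αf d ≢ d
    connected   : ∀ a b → Reach σf αf a b
    -- planarity: Euler's formula V − E + F = 2 with E = n/2, i.e. 2V + 2F = n + 4
    euler       : 2 * #cycles σf + 2 * #cycles φf ≡ n + 4
    -- every vertex has even degree (degree = length of the σ-orbit)
    even-degree : ∀ d → ∃[ k ] ((iter σf (2 * suc k) d ≡ d)
                                × (∀ j → 0 < j → j < 2 * suc k → iter σf j d ≢ d))
    dark-face   : ∀ d → darkR (φf d) ≡ darkR d
    dark-proper : ∀ d → darkR (αf d) ≡ not (darkR d)

module _ {n : ℕ} (H : Hypermap n) where
  open Hypermap H

  SameVertex : Fin n → Fin n → Set
  SameVertex x y = ∃[ k ] iter σf k x ≡ y

  -- vertex labellings: functions on darts constant on vertices
  IsVertexLabelling : (Fin n → ℤ) → Set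
  IsVertexLabelling ℓ = ∀ d → ℓ (σf d) ≡ ℓ d

  -- mirror-well-labelling: for a dart e from a to b (b = origin of αf e) with the
  -- dark face on its left (darkR e ≡ false), ℓ(b) ≥ ℓ(a) − 1
  IsMirrorWellLabelling : (Fin n → ℤ) → Set
  IsMirrorWellLabelling ℓ =
    IsVertexLabelling ℓ × (∀ e → darkR e ≡ false → ℓ e ℤ.- + 1 ℤ.≤ ℓ (αf e))

  -- the vertex u (origin of dart x) is a right local min: every right neighbour w,
  -- i.e. with an edge dart e from w to u having the dark face on its right,
  -- satisfies ℓ(w) ≥ ℓ(u)
  IsRightLocalMin : (Fin n → ℤ) → Fin n → Set
  IsRightLocalMin ℓ x = ∀ e → darkR e ≡ true → SameVertex (αf e) x → ℓ x ℤ.≤ ℓ e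

  -- directed paths of length k in the canonical orientation (each edge oriented
  -- so that its dark face is on its right), from the vertex of x to the vertex of y
  data DPath (x y : Fin n) : ℕ → Set where
    dnil  : SameVertex x y → DPath x y 0
    dcons : ∀ {k} (e : Fin n) → SameVertex x e → darkR e ≡ true
          → DPath (αf e) y k → DPath x y (suc k)

  IsGeodesicLabelling : (Fin n → ℤ) → Fin n → Set
  IsGeodesicLabelling ℓ v = ∀ d → ∃[ k ] ((ℓ d ≡ + k) × DPath v d k × (∀ j → DPath v d j → k ≤ j))

  Good : (Fin n → ℤ) → Fin n → Set
  Good ℓ v = IsMirrorWellLabelling ℓ × (ℓ v ≡ + 0) × IsRightLocalMin ℓ v
             × (∀ x → IsRightLocalMin ℓ x → SameVertex x v)

module Submission where

open import Defs
open import Data.Nat using (ℕ)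
open import Data.Fin using (Fin)
open import Data.Integer using (ℤ)
open import Data.Product using (∃-syntax; _×_)
open import Relation.Binary.PropositionalEquality using (_≡_)

open import Data.Nat using (zero; suc; _+_; _*_; _≤_; z≤n; s≤s)
import Data.Nat.Properties as ℕP
open import Data.Nat.DivMod using (_%_; _/_; m%n<n; m≡m%n+[m/n]*n)
open import Data.Fin using (toℕ; fromℕ<)
import Data.Fin.Properties as FinP
open import Data.Fin.Permutation using (Permutation′; _⟨$⟩ʳ_; _⟨$⟩ˡ_; inverseˡ)
import Data.Integer as ℤ
open import Data.Integer using (+_; +≤+; +<+; -<+)
import Data.Integer.Properties as ℤP
open import Data.Bool using (true; false; not)
import Data.Bool.Properties as BoolP
open import Data.Product using (_,_; proj₁; proj₂)
open import Data.Sum using (inj₁; inj₂)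
open import Data.Empty using (⊥-elim)
open import Relation.Nullary using (Dec; yes; no)
open import Relation.Nullary.Decidable using (_×-dec_)
open import Relation.Binary.PropositionalEquality
  using (refl; sym; trans; cong; subst; subst₂; module ≡-Reasoning)
open import Function.Definitions using (Injective)

-- Let dist u be the length of a shortest directed path from
-- the pointed vertex v to u in the canonical orientation.  Two facts drive it.
--  (1) The canonical orientation is strongly connected: an edge traversed
--      against its orientation can be replaced by the directed walk around
--      the dark face on its other side, so connectivity of the map gives a
--      directed path between any two vertices, and dist is well defined by
--      the least-number principle (directed paths of a given length being
--      decidable).
--  (2) A mirror-well-labelling grows by at most one along an oriented edge,
--      hence by at most k along a directed path of length k.
-- Existence: dist is such a labelling, and no vertex u ≠ v is a right local
-- min, because the last edge of a geodesic to u starts at a right neighbour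
-- of smaller label.  Uniqueness and geodesicity: for a good labelling ℓ,
-- (2) gives ℓ ≤ dist; conversely, by complete induction on ℓ (bounded below
-- on the finitely many darts) there is a directed path from v to u of length
-- at most ℓ u, since u ≠ v has a right neighbour w with ℓ w < ℓ u ≤ ℓ w + 1.
-- The file first develops the generic facts used (orbits of injective maps
-- on Fin n, a least-number principle, induction along an integer measure)
-- and then the argument on hypermaps.

iter-+ : ∀ {A : Set} (f : A → A) a b x → iter f (a + b) x ≡ iter f a (iter f b x)
iter-+ f zero    b x = refl
iter-+ f (suc a) b x = cong f (iter-+ f a b x)

iter-injective : ∀ {A : Set} {f : A → A} → Injective _≡_ _≡_ f
               → ∀ k → Injective _≡_ _≡_ (iter f k)
iter-injective f-inj zero    eq = eq
iter-injective f-inj (suc k) eq = iter-injective f-inj k (f-inj eq)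

iter-multiple : ∀ {A : Set} (f : A → A) {p x} → iter f p x ≡ x → ∀ q → iter f (q * p) x ≡ x
iter-multiple f         per zero    = refl
iter-multiple f {p} {x} per (suc q) = begin
  iter f (p + q * p) x       ≡⟨ iter-+ f p (q * p) x ⟩
  iter f p (iter f (q * p) x) ≡⟨ cong (iter f p) (iter-multiple f per q) ⟩
  iter f p x                 ≡⟨ per ⟩
  x                          ∎
  where open ≡-Reasoning

iter-mod : ∀ {A : Set} (f : A → A) {m x} → iter f (suc m) x ≡ x
         → ∀ k → iter f k x ≡ iter f (k % suc m) x
iter-mod f {m} {x} per k = begin
  iter f k x                                         ≡⟨ cong (λ t → iter f t x) (m≡m%n+[m/n]*n k (suc m)) ⟩
  iter f (k % suc m + (k / suc m) * suc m) x         ≡⟨ iter-+ f (k % suc m) _ x ⟩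
  iter f (k % suc m) (iter f ((k / suc m) * suc m) x) ≡⟨ cong (iter f (k % suc m)) (iter-multiple f per (k / suc m)) ⟩
  iter f (k % suc m) x                               ∎
  where open ≡-Reasoning

Orbit : ∀ {A : Set} → (A → A) → A → A → Set
Orbit f x y = ∃[ k ] iter f k x ≡ y

orbit-refl : ∀ {A : Set} (f : A → A) x → Orbit f x x
orbit-refl f x = 0 , refl

orbit-step : ∀ {A : Set} (f : A → A) x → Orbit f x (f x)
orbit-step f x = 1 , refl

orbit-trans : ∀ {A : Set} (f : A → A) {x y z} → Orbit f x y → Orbit f y z → Orbit f x z
orbit-trans f {x} (a , refl) (b , refl) = b + a , iter-+ f b a x

orbit-invariant : ∀ {A B : Set} (f : A → A) {g : A → B} → (∀ x → g (f x) ≡ g x)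
                → ∀ {x y} → Orbit f x y → g x ≡ g y
orbit-invariant f inv (zero  , refl) = refl
orbit-invariant f inv (suc k , refl) = trans (orbit-invariant f inv (k , refl)) (sym (inv _))

-- On a finite set an injective map is a permutation: every point is
-- periodic, so orbits are cycles (a symmetric relation) and membership in
-- an orbit is decidable by inspecting one period.
module FiniteOrbits {n : ℕ} (f : Fin n → Fin n) (f-inj : Injective _≡_ _≡_ f) where

  period : ∀ x → ∃[ m ] iter f (suc m) x ≡ x
  period x with FinP.pigeonhole (ℕP.n<1+n n) (λ i → iter f (toℕ i) x)
  ... | i , j , i<j , eq with ℕP.m≤n⇒∃[o]m+o≡n i<j
  ... | m , i+1+m≡j = m , sym (iter-injective f-inj (toℕ i) (begin
    iter f (toℕ i) x               ≡⟨ eq ⟩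
    iter f (toℕ j) x               ≡⟨ cong (λ t → iter f t x) (trans (sym i+1+m≡j) (sym (ℕP.+-suc (toℕ i) m))) ⟩
    iter f (toℕ i + suc m) x       ≡⟨ iter-+ f (toℕ i) (suc m) x ⟩
    iter f (toℕ i) (iter f (suc m) x) ∎))
    where open ≡-Reasoning

  orbit-sym : ∀ {x y} → Orbit f x y → Orbit f y x
  orbit-sym {x} (k , refl) with period x
  ... | m , per = k * m , (begin
    iter f (k * m) (iter f k x) ≡⟨ sym (iter-+ f (k * m) k x) ⟩
    iter f (k * m + k) x        ≡⟨ cong (λ t → iter f t x) (trans (ℕP.+-comm (k * m) k) (sym (ℕP.*-suc k m))) ⟩
    iter f (k * suc m) x        ≡⟨ iter-multiple f per k ⟩
    x                           ∎)
    where open ≡-Reasoning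

  orbit? : ∀ x y → Dec (Orbit f x y)
  orbit? x y with period x
  ... | m , per with FinP.any? (λ (i : Fin (suc m)) → iter f (toℕ i) x FinP.≟ y)
  ... | yes (i , hit) = yes (toℕ i , hit)
  ... | no  miss      = no λ { (k , hit) → miss (fromℕ< (m%n<n k (suc m)) ,
          trans (cong (λ t → iter f t x) (FinP.toℕ-fromℕ< (m%n<n k (suc m))))
                (trans (sym (iter-mod f per k)) hit)) }

permutation-injective : ∀ {n} (π : Permutation′ n) → Injective _≡_ _≡_ (π ⟨$⟩ʳ_)
permutation-injective π eq = trans (sym (inverseˡ π)) (trans (cong (π ⟨$⟩ˡ_) eq) (inverseˡ π))

least : (P : ℕ → Set) → (∀ k → Dec (P k)) → ∀ {m} → P m
      → ∃[ k ] (P k × (∀ j → P j → k ≤ j))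
least P P? {m} pm with P? 0
... | yes p0 = 0 , p0 , λ _ _ → z≤n
least P P? {zero}  pm | no ¬p0 = ⊥-elim (¬p0 pm)
least P P? {suc m} pm | no ¬p0 with least (λ k → P (suc k)) (λ k → P? (suc k)) pm
... | k , pk , below = suc k , pk , λ { zero pj → ⊥-elim (¬p0 pj) ; (suc j) pj → s≤s (below j pj) }

finite-lower-bound : ∀ {m} (f : Fin m → ℤ) → ∃[ L ] (∀ i → L ℤ.≤ f i)
finite-lower-bound {zero}  f = + 0 , λ ()
finite-lower-bound {suc m} f with finite-lower-bound (λ i → f (Fin.suc i))
... | L , L≤f with ℤP.≤-total (f Fin.zero) L
... | inj₁ f₀≤L = f Fin.zero , λ { Fin.zero → ℤP.≤-refl ; (Fin.suc i) → ℤP.≤-trans f₀≤L (L≤f i) }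
... | inj₂ L≤f₀ = L , λ { Fin.zero → L≤f₀ ; (Fin.suc i) → L≤f i }

measure-induction : ∀ {A : Set} (μ : A → ℤ) (L : ℤ) → (∀ x → L ℤ.≤ μ x)
                  → (P : A → Set) → (∀ x → (∀ y → μ y ℤ.< μ x → P y) → P x)
                  → ∀ x → P x
measure-induction μ L L≤μ P step x = bounded (suc ℤ.∣ μ x ℤ.- L ∣) x (<-suc-abs _)
  where
  <-suc-abs : ∀ i → i ℤ.< + suc ℤ.∣ i ∣
  <-suc-abs (+ a)      = +<+ (ℕP.n<1+n a)
  <-suc-abs ℤ.-[1+ a ] = -<+

  bounded : ∀ N y → μ y ℤ.- L ℤ.< + N → P y
  bounded zero    y lt = ⊥-elim (ℤP.<-irrefl refl (ℤP.<-≤-trans lt (ℤP.i≤j⇒0≤j-i (L≤μ y))))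
  bounded (suc N) y lt = step y λ z μz<μy →
    bounded N z (ℤP.<-≤-trans (ℤP.+-monoˡ-< (ℤ.- L) μz<μy) (ℤP.i<j⇒i≤pred[j] lt))

minus-one≡pred : ∀ x → x ℤ.- + 1 ≡ ℤ.pred x
minus-one≡pred x = ℤP.+-comm x (ℤ.- + 1)

minus-one≤⇒≤suc : ∀ {x y} → x ℤ.- + 1 ℤ.≤ y → x ℤ.≤ ℤ.suc y
minus-one≤⇒≤suc {x} {y} h =
  subst (ℤ._≤ ℤ.suc y) (ℤP.suc-pred x) (ℤP.suc-mono (subst (ℤ._≤ y) (minus-one≡pred x) h))

≤suc⇒minus-one≤ : ∀ {x y} → x ℤ.≤ ℤ.suc y → x ℤ.- + 1 ℤ.≤ y
≤suc⇒minus-one≤ {x} {y} h = subst₂ ℤ._≤_ (sym (minus-one≡pred x)) (ℤP.pred-suc y) (ℤP.pred-mono h)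

+-suc : ∀ k i → + k ℤ.+ ℤ.suc i ≡ + suc k ℤ.+ i
+-suc k i = trans (sym (ℤP.+-assoc (+ k) (+ 1) i)) (cong (λ t → + t ℤ.+ i) (ℕP.+-comm k 1))

module _ {n : ℕ} (H : Hypermap n) where
  open Hypermap H

  _∼_ : Fin n → Fin n → Set
  x ∼ y = SameVertex H x y

  open FiniteOrbits σf (permutation-injective σ)
    using () renaming (orbit-sym to ∼-sym; orbit? to _∼?_)

  ∼-refl : ∀ x → x ∼ x
  ∼-refl = orbit-refl σf

  ∼-trans : ∀ {x y z} → x ∼ y → y ∼ z → x ∼ z
  ∼-trans = orbit-trans σf

  ∼-σ : ∀ x → x ∼ σf x
  ∼-σ = orbit-step σf

  φ-injective : Injective _≡_ _≡_ φf
  φ-injective eq = permutation-injective α (permutation-injective σ eq)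

  path-pre : ∀ {w x y k} → w ∼ x → DPath H x y k → DPath H w y k
  path-pre s (dnil s′)         = dnil (∼-trans s s′)
  path-pre s (dcons e s′ dk p) = dcons e (∼-trans s s′) dk p

  path-post : ∀ {x y z k} → DPath H x y k → y ∼ z → DPath H x z k
  path-post (dnil s)         s′ = dnil (∼-trans s s′)
  path-post (dcons e s dk p) s′ = dcons e s dk (path-post p s′)

  path-++ : ∀ {x y z a b} → DPath H x y a → DPath H y z b → DPath H x z (a + b)
  path-++ (dnil s)         q = path-pre s q
  path-++ (dcons e s dk p) q = dcons e s dk (path-++ p q)

  path-snoc : ∀ {x y e z k} → DPath H x y k → y ∼ e → darkR e ≡ true → αf e ∼ z
            → DPath H x z (suc k)
  path-snoc (dnil s)         s₁ dk s₂ = dcons _ (∼-trans s s₁) dk (dnil s₂)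
  path-snoc (dcons e s dk p) s₁ de s₂ = dcons e s dk (path-snoc p s₁ de s₂)

  path-last : ∀ {x y k} → DPath H x y (suc k)
            → ∃[ e ] (DPath H x e k × darkR e ≡ true × αf e ∼ y)
  path-last (dcons e s dk (dnil s′)) = e , dnil s , dk , s′
  path-last (dcons e s dk (dcons e′ s′ dk′ p)) with path-last (dcons e′ s′ dk′ p)
  ... | f , q , df , sf = f , dcons e s dk q , df , sf

  path? : ∀ x y k → Dec (DPath H x y k)
  path? x y zero with x ∼? y
  ... | yes s = yes (dnil s)
  ... | no ¬s = no λ { (dnil s) → ¬s s }
  path? x y (suc k)
    with FinP.any? (λ e → (x ∼? e) ×-dec (darkR e BoolP.≟ true) ×-dec path? (αf e) y k)
  ... | yes (e , s , dk , p) = yes (dcons e s dk p)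
  ... | no ¬p = no λ { (dcons e s dk p) → ¬p (e , s , dk , p) }

  -- The boundary of a dark face is a directed cycle: from φ c, walking
  -- along the face reaches φ^(i+1) c in i steps.
  dark-face-iter : ∀ {c} → darkR c ≡ true → ∀ i → darkR (iter φf i c) ≡ true
  dark-face-iter dc zero    = dc
  dark-face-iter dc (suc i) = trans (dark-face _) (dark-face-iter dc i)

  face-path : ∀ {c} → darkR c ≡ true → ∀ i → DPath H (φf c) (iter φf (suc i) c) i
  face-path dc zero    = dnil (∼-refl _)
  face-path dc (suc i) = path-snoc (face-path dc i) (∼-refl _) (dark-face-iter dc (suc i)) (∼-σ _)

  -- An edge traversed against its orientation (dark face on its left) is
  -- bypassed by going around the dark face on its other side.
  against-orientation : ∀ {b} → darkR b ≡ false → ∃[ k ] DPath H b (αf b) k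
  against-orientation {b} db with FiniteOrbits.period φf φ-injective (αf b)
  ... | m , per = m , path-pre (1 , cong σf (sym (α-invol b)))
                                (path-post (face-path dark-αb m) (0 , per))
    where
    dark-αb : darkR (αf b) ≡ true
    dark-αb = trans (dark-proper b) (cong not db)

  strongly-connected : ∀ x d → ∃[ k ] DPath H x d k
  strongly-connected x d = along (connected x d)
    where
    along : ∀ {d} → Reach σf αf x d → ∃[ k ] DPath H x d k
    along reach-refl = 0 , dnil (∼-refl x)
    along (reach-σ r) with along r
    ... | k , p = k , path-post p (∼-σ _)
    along (reach-α {b} r) with along r | darkR b in db
    ... | k , p | true  = suc k , path-snoc p (∼-refl b) db (∼-refl _)
    ... | k , p | false with against-orientation db
    ... | j , q = k + j , path-++ p q

  module Geodesic (v : Fin n) where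

    geodesic : ∀ d → ∃[ k ] (DPath H v d k × (∀ j → DPath H v d j → k ≤ j))
    geodesic d = least (DPath H v d) (path? v d) (proj₂ (strongly-connected v d))

    dist : Fin n → ℕ
    dist d = proj₁ (geodesic d)

    dist-path : ∀ d → DPath H v d (dist d)
    dist-path d = proj₁ (proj₂ (geodesic d))

    dist-min : ∀ d j → DPath H v d j → dist d ≤ j
    dist-min d = proj₂ (proj₂ (geodesic d))

    dist-∼ : ∀ {x y} → x ∼ y → dist y ≤ dist x
    dist-∼ {x} {y} s = dist-min y _ (path-post (dist-path x) s)

    dist-v : dist v ≡ 0
    dist-v = ℕP.n≤0⇒n≡0 (dist-min v 0 (dnil (∼-refl v)))

    label : Fin n → ℤ
    label d = + dist d

    label-vertex : IsVertexLabelling H label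
    label-vertex d = cong +_ (ℕP.≤-antisym (dist-∼ (∼-σ d)) (dist-∼ (∼-sym (∼-σ d))))

    -- for e with the dark face on its left, αf e is an oriented edge back
    -- to the origin of e
    label-mirror-well : IsMirrorWellLabelling H label
    label-mirror-well = label-vertex , λ e de →
      ≤suc⇒minus-one≤ (+≤+ (dist-min e _ (path-snoc (dist-path (αf e)) (∼-refl _)
                          (trans (dark-proper e) (cong not de)) (0 , α-invol e))))

    label-v : label v ≡ + 0
    label-v = cong +_ dist-v

    label-min-v : IsRightLocalMin H label v
    label-min-v e de s = subst (ℤ._≤ label e) (sym label-v) (+≤+ z≤n)

    -- a vertex at distance k+1 has a right neighbour at distance ≤ k
    label-min-only-v : ∀ x → IsRightLocalMin H label x → x ∼ v
    label-min-only-v x min = from-geodesic (dist x) (dist-path x) (λ e de s → ℤP.drop‿+≤+ (min e de s))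
      where
      from-geodesic : ∀ k → DPath H v x k → (∀ e → darkR e ≡ true → αf e ∼ x → k ≤ dist e) → x ∼ v
      from-geodesic zero    (dnil s) below = ∼-sym s
      from-geodesic (suc k) p        below with path-last p
      ... | e , q , de , s = ⊥-elim (ℕP.<-irrefl refl (ℕP.≤-trans (below e de s) (dist-min e k q)))

    label-good : Good H label v
    label-good = label-mirror-well , label-v , label-min-v , label-min-only-v

    module _ {ℓ : Fin n → ℤ} (good : Good H ℓ v) where
      ℓ-vertex : IsVertexLabelling H ℓ
      ℓ-vertex = proj₁ (proj₁ good)

      ℓ-∼ : ∀ {x y} → x ∼ y → ℓ x ≡ ℓ y
      ℓ-∼ = orbit-invariant σf ℓ-vertex

      ℓ-edge : ∀ e → darkR e ≡ true → ℓ (αf e) ℤ.≤ ℤ.suc (ℓ e)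
      ℓ-edge e de = minus-one≤⇒≤suc (subst (λ t → ℓ (αf e) ℤ.- + 1 ℤ.≤ ℓ t) (α-invol e)
                      (proj₂ (proj₁ good) (αf e) (trans (dark-proper e) (cong not de))))

      ℓ-path : ∀ {x y k} → DPath H x y k → ℓ y ℤ.≤ + k ℤ.+ ℓ x
      ℓ-path {x} (dnil s) = ℤP.≤-reflexive (trans (sym (ℓ-∼ s)) (sym (ℤP.+-identityˡ (ℓ x))))
      ℓ-path {x} {y} {suc k} (dcons e s de p) = begin
        ℓ y                  ≤⟨ ℓ-path p ⟩
        + k ℤ.+ ℓ (αf e)     ≤⟨ ℤP.+-monoʳ-≤ (+ k) (ℓ-edge e de) ⟩
        + k ℤ.+ ℤ.suc (ℓ e)  ≡⟨ +-suc k (ℓ e) ⟩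
        + suc k ℤ.+ ℓ e      ≡⟨ cong (ℤ._+_ (+ suc k)) (sym (ℓ-∼ s)) ⟩
        + suc k ℤ.+ ℓ x      ∎
        where open ℤP.≤-Reasoning

      -- apply ℓ-path to a geodesic from v, where ℓ v = 0
      ℓ≤dist : ∀ d → ℓ d ℤ.≤ label d
      ℓ≤dist d = subst (ℓ d ℤ.≤_) (trans (cong (ℤ._+_ (+ dist d)) (proj₁ (proj₂ good)))
                                         (ℤP.+-identityʳ (label d)))
                                  (ℓ-path (dist-path d))

      -- every vertex u is reached from v by a path of length at most ℓ u:
      -- either u is a right local min, hence u = v, or it has a right
      -- neighbour of smaller label, to which induction applies
      short-path : ∀ d → ∃[ k ] (DPath H v d k × + k ℤ.≤ ℓ d)
      short-path = measure-induction ℓ (proj₁ (finite-lower-bound ℓ)) (proj₂ (finite-lower-bound ℓ))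
                                     _ step
        where
        step : ∀ d → (∀ e → ℓ e ℤ.< ℓ d → ∃[ k ] (DPath H v e k × + k ℤ.≤ ℓ e))
             → ∃[ k ] (DPath H v d k × + k ℤ.≤ ℓ d)
        step d ih with FinP.any? (λ e → (darkR e BoolP.≟ true) ×-dec (αf e ∼? d) ×-dec (ℓ e ℤP.<? ℓ d))
        ... | yes (e , de , s , ℓe<ℓd) with ih e ℓe<ℓd
        ...   | k , p , k≤ℓe = suc k , path-snoc p (∼-refl e) de s , ℤP.i<j⇒suc[i]≤j (ℤP.≤-<-trans k≤ℓe ℓe<ℓd)
        step d ih | no none = 0 , dnil (∼-sym d∼v) ,
                              ℤP.≤-reflexive (sym (trans (ℓ-∼ d∼v) (proj₁ (proj₂ good))))
          where
          d∼v : d ∼ v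
          d∼v = proj₂ (proj₂ (proj₂ good)) d λ e de s → ℤP.≮⇒≥ λ ℓe<ℓd → none (e , de , s , ℓe<ℓd)

      dist≤ℓ : ∀ d → label d ℤ.≤ ℓ d
      dist≤ℓ d with short-path d
      ... | k , p , k≤ℓd = ℤP.≤-trans (+≤+ (dist-min d k p)) k≤ℓd

      ℓ≡label : ∀ d → ℓ d ≡ label d
      ℓ≡label d = ℤP.≤-antisym (ℓ≤dist d) (dist≤ℓ d)

claim4 : ∀ {n} (H : Hypermap n) (v : Fin n)
       → (∃[ ℓ ] Good H ℓ v)
         × (∀ ℓ ℓ′ → Good H ℓ v → Good H ℓ′ v → ∀ d → ℓ d ≡ ℓ′ d)
         × (∀ ℓ → Good H ℓ v → IsGeodesicLabelling H ℓ v)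
claim4 H v = (label , label-good)
           , (λ ℓ ℓ′ good good′ d → trans (ℓ≡label good d) (sym (ℓ≡label good′ d)))
           , (λ ℓ good d → dist d , ℓ≡label good d , dist-path d , dist-min d)
  where open Geodesic H v
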